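{- Let $\Gamma$ be an abelian group written additively and let $\varphi,\psi$ be $\Gamma$-gain functions on a finite graph $G$. Then $\varphi$ and $\psi$ are shifting equivalent if and only if $\varphi(\vec B)=\psi(\vec B)$ for every oriented bond $\vec B$ of $G$.
   Context: A $\Gamma$-gain function on $G$ assigns to each oriented edge $e$ a value $\varphi(e)\in\Gamma$ with $\varphi(-e)=-\varphi(e)$, where $-e$ is the reverse orientation. A bond is a minimal nonempty edge cut; an oriented bond $\vec B$ is a bond $\delta(X)$ ($\delta(X)$ being the non-loop edges with exactly one endpoint in $X$) with all edges oriented away from $X$ or all towards $X$, and $\varphi(\vec B)=\sum_{e\in\vec B}\varphi(e)$. For a cycle $C$ with oriented edges $e_1,\dots,e_k$ in cyclic order in one direction and $a\in\Gamma$, $\psi_{C,a}$ is the gain function with $\psi_{C,a}(e_i)=a$ for all $i$ and $\psi_{C,a}(e)=0$ for every edge not on $C$. A shift replaces a gain function $\varphi$ by $\varphi+\psi_{C,a}$; two gain functions are shifting equivalent if one is obtained from the other by a finite sequence of shifts. -}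

module Defs where

open import Level using (Level; _⊔_) renaming (suc to lsuc)
open import Data.Nat using (ℕ; zero; suc)
open import Data.Fin using (Fin; zero; suc)
open import Data.Fin.Properties using () renaming (_≟_ to _≟ᶠ_)
open import Data.Bool using (Bool; true; false; if_then_else_; T; _xor_; not)
open import Data.Maybe using (Maybe; just; nothing)
open import Data.List using (List; []; _∷_; map)
open import Data.List.Relation.Unary.Unique.Propositional using (Unique)
open import Data.Product using (Σ; ∃; _×_; _,_; proj₁; proj₂)
open import Relation.Binary.PropositionalEquality using (_≡_; _≢_)
open import Relation.Nullary using (yes; no; ¬_)
open import Algebra.Bundles using (AbelianGroup)

-- Finite graphs (multigraphs; loops and parallel edges allowed).
-- Vertices are Fin nV, edges are Fin nE; each edge carries a fixed
-- reference orientation given by (tail, head).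

record Graph : Set where
  field
    nV  : ℕ
    nE  : ℕ
    ends : Fin nE → Fin nV × Fin nV

module _ (G : Graph) where
  open Graph G

  Vertex : Set
  Vertex = Fin nV

  Edge : Set
  Edge = Fin nE

  -- An oriented edge: an edge together with a direction
  -- (true = reference orientation, false = reversed orientation).
  OEdge : Set
  OEdge = Edge × Bool

  rev : OEdge → OEdge
  rev (e , b) = (e , not b)

  otail : OEdge → Vertex
  otail (e , true)  = proj₁ (ends e)
  otail (e , false) = proj₂ (ends e)

  ohead : OEdge → Vertex
  ohead (e , true)  = proj₂ (ends e)
  ohead (e , false) = proj₁ (ends e)

  isLoop : Edge → Bool
  isLoop e with proj₁ (ends e) ≟ᶠ proj₂ (ends e)
  ... | yes _ = true
  ... | no  _ = false

  Linked : Vertex → List OEdge → Vertex → Set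
  Linked v []       w = v ≡ w
  Linked v (o ∷ os) w = (otail o ≡ v) × Linked (ohead o) os w

  record Cycle : Set where
    field
      oedges   : List OEdge
      nonempty : oedges ≢ []
      closed   : Σ Vertex λ v → Linked v oedges v
      distinctV : Unique (map otail oedges)
      distinctE : Unique (map proj₁ oedges)

  VSet : Set
  VSet = Vertex → Bool

  ESet : Set
  ESet = Edge → Bool

  δ : VSet → ESet
  δ X e = if isLoop e then false else (X (proj₁ (ends e)) xor X (proj₂ (ends e)))

  _⊆ᴱ_ : ESet → ESet → Set
  S ⊆ᴱ T = ∀ e → Data.Bool.T (S e) → Data.Bool.T (T e)

  _≐ᴱ_ : ESet → ESet → Set
  S ≐ᴱ T = ∀ e → S e ≡ T e

  NonemptyE : ESet → Set
  NonemptyE S = Σ Edge λ e → T (S e)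

  IsEdgeCut : ESet → Set
  IsEdgeCut S = Σ VSet λ Y → S ≐ᴱ δ Y

  IsBond : ESet → Set
  IsBond S = IsEdgeCut S × NonemptyE S ×
             (∀ S' → IsEdgeCut S' → NonemptyE S' → S' ⊆ᴱ S → S' ≐ᴱ S)

-- Gain functions.  A Γ-gain function is determined by its values on the
-- reference orientations; its value on -e is defined as -(value on e),
-- so φ(-e) = -φ(e) holds by definition.

module GainDefs {c ℓ : Level} (Γ : AbelianGroup c ℓ) (G : Graph) where
  open AbelianGroup Γ renaming (Carrier to A; _∙_ to _+_; ε to 0#; _⁻¹ to -_)
  open Graph G

  GainFn : Set c
  GainFn = Edge G → A

  gainO : GainFn → OEdge G → A
  gainO φ (e , true)  = φ e
  gainO φ (e , false) = - (φ e)

  _≋_ : GainFn → GainFn → Set ℓ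
  φ ≋ ψ = ∀ e → φ e ≈ ψ e

  _⊕_ : GainFn → GainFn → GainFn
  (φ ⊕ ψ) e = φ e + ψ e

  dirIn : List (OEdge G) → Edge G → Maybe Bool
  dirIn []             e = nothing
  dirIn ((f , b) ∷ os) e with f ≟ᶠ e
  ... | yes _ = just b
  ... | no  _ = dirIn os e

  ψC : Cycle G → A → GainFn
  ψC C a e with dirIn (Cycle.oedges C) e
  ... | just true  = a
  ... | just false = - a
  ... | nothing    = 0#

  data ShiftEquiv : GainFn → GainFn → Set (c ⊔ ℓ) where
    done  : ∀ {φ ψ} → φ ≋ ψ → ShiftEquiv φ ψ
    shift : ∀ {φ ψ} (C : Cycle G) (a : A) →
            ShiftEquiv (φ ⊕ ψC C a) ψ → ShiftEquiv φ ψ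

  sumE : ∀ {k} → (Fin k → A) → A
  sumE {zero}  f = 0#
  sumE {suc k} f = f zero + sumE (λ i → f (suc i))

  -- φ(B⃗) for the oriented bond δ(X), oriented away from X (away = true)
  -- or towards X (away = false).
  bondGain : GainFn → VSet G → Bool → A
  bondGain φ X away = sumE term
    where
      term : Edge G → A
      term e = if δ G X e
               then (if (X (proj₁ (ends e)) xor not away) then φ e else - (φ e))
               else 0#

-- Shifting along a cycle leaves every cut gain unchanged: the contribution of a gain a on an
-- oriented edge to the cut gain of δ X is the drop of a potential (a on one side of X, 0 on
-- the other) along that edge, and these drops cancel around a closed walk.
--
-- Conversely, make φ agree with ψ edge by edge, in decreasing order of index. If the ends of e
-- are joined by a walk through smaller edges, shifting along the cycle it closes with e fixes
-- e and leaves larger edges alone. Otherwise some bond contains e and, apart from e, only larger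
-- edges, on which φ and ψ already agree; equality of the two bond gains then forces it at e.
module Submission where

open import Defs
open import Level using (Level; _⊔_)
open import Function using (_∘_; Equivalence)
open import Data.Bool using (Bool; true; false; not; _xor_; if_then_else_; T)
open import Data.Bool.Properties using (xor-same; ¬-not; T-≡; not-distribˡ-xor)
  renaming (_≟_ to _≟ᵇ_)
open import Data.Empty using (⊥-elim)
open import Data.Fin as Fin using (Fin; toℕ; fromℕ; inject₁; punchIn; _<_; _≤_)
open import Data.Fin.Properties
  using (toℕ-fromℕ; toℕ-inject₁; toℕ<n; punchInᵢ≢i; <-cmp; <-irrefl; <-asym; <⇒≢; ≤∧≢⇒<)
  renaming (_≟_ to _≟ᶠ_; _<?_ to _<ᶠ?_)
open import Data.List using (List; []; _∷_; map; _++_; [_]; allFin)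
open import Data.List.Membership.Propositional.Properties using (∈-allFin)
open import Data.List.Relation.Unary.All as All using (All; []; _∷_)
open import Data.List.Relation.Unary.All.Properties using (map⁺; map⁻; ¬Any⇒All¬; ++⁻ˡ; ++⁻ʳ)
open import Data.List.Relation.Unary.AllPairs using ([]; _∷_)
open import Data.List.Relation.Unary.Any using (Any; here; there; any?)
open import Data.List.Relation.Unary.Unique.Propositional using (Unique)
open import Data.Maybe using (Maybe; just; nothing; maybe′)
open import Data.Nat as ℕ using (ℕ; zero; suc)
open import Data.Nat.Properties using (<⇒≱)
open import Data.Product using (Σ; _×_; _,_; proj₁; proj₂)
open import Data.Sum using (_⊎_; inj₁; inj₂; [_,_]′)
open import Relation.Binary.PropositionalEquality
  using (_≡_; _≢_; refl; sym; trans; cong; subst; subst₂)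
open import Relation.Binary.Definitions using (tri<; tri≈; tri>)
open import Relation.Nullary using (Dec; yes; no; ¬_; does; contradiction)
open import Relation.Nullary.Decidable using (_×-dec_)
open import Relation.Unary using (Decidable)
open import Algebra.Bundles using (AbelianGroup; CommutativeMonoid; Group)
open import Data.Vec.Functional using (Vector; removeAt)
import Relation.Binary.Reasoning.Setoid as ≈-Reasoning

Unique-rotate : ∀ {A : Set} (xs : List A) x → Unique (xs ++ [ x ]) → Unique (x ∷ xs)
Unique-rotate []       x _ = [] ∷ []
Unique-rotate (y ∷ xs) x (y∉ ∷ un) with Unique-rotate xs x un
... | x∉ ∷ un′ = ((λ x≡y → All.head (++⁻ʳ xs y∉) (sym x≡y)) ∷ x∉) ∷ (++⁻ˡ xs y∉ ∷ un′)

downward-induction : ∀ {n p} (P : ℕ → Set p) → P n →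
                     (∀ (i : Fin n) → P (suc (toℕ i)) → P (toℕ i)) → P 0
downward-induction {zero}  P Pn step = Pn
downward-induction {suc n} P Pn step = downward-induction P Pn′ step′
  where
    Pn′ : P n
    Pn′ = subst P (toℕ-fromℕ n) (step (fromℕ n) (subst P (cong suc (sym (toℕ-fromℕ n))) Pn))

    step′ : ∀ (i : Fin n) → P (suc (toℕ i)) → P (toℕ i)
    step′ i = subst P (toℕ-inject₁ i) ∘ step (inject₁ i) ∘ subst P (cong suc (sym (toℕ-inject₁ i)))

module GraphProperties (G : Graph) where
  open Graph G

  V : Set
  V = Vertex G

  E : Set
  E = Edge G

  tl hd : E → V
  tl e = proj₁ (ends e)
  hd e = proj₂ (ends e)

  loop⇒tl≡hd : ∀ e → isLoop G e ≡ true → tl e ≡ hd e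
  loop⇒tl≡hd e with tl e ≟ᶠ hd e
  ... | yes eq = λ _ → eq
  ... | no _   = λ ()

  module _ (X : VSet G) {e : E} where

    sameSide⇒δ≡false : X (tl e) ≡ X (hd e) → δ G X e ≡ false
    sameSide⇒δ≡false eq with isLoop G e
    ... | true  = refl
    ... | false = trans (cong (_xor X (hd e)) eq) (xor-same (X (hd e)))

    δ≡false⇒sameSide : δ G X e ≡ false → X (tl e) ≡ X (hd e)
    δ≡false⇒sameSide with isLoop G e in loop
    ... | true  = λ _ → cong X (loop⇒tl≡hd e loop)
    ... | false with X (tl e) | X (hd e)
    ... | true  | true  = λ _ → refl
    ... | false | false = λ _ → refl
    ... | true  | false = λ ()
    ... | false | true  = λ ()

    δ≡true⇒sidesDiffer : δ G X e ≡ true → X (tl e) ≢ X (hd e)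
    δ≡true⇒sidesDiffer δe eq = contradiction (trans (sym δe) (sameSide⇒δ≡false eq)) λ ()

    sidesDiffer⇒δ≡true : X (tl e) ≢ X (hd e) → δ G X e ≡ true
    sidesDiffer⇒δ≡true differ with δ G X e in δe
    ... | true  = refl
    ... | false = contradiction (δ≡false⇒sameSide δe) differ

    leaves⇒δ≡true : X (tl e) ≡ true → X (hd e) ≡ false → δ G X e ≡ true
    leaves⇒δ≡true tail∈X head∉X =
      sidesDiffer⇒δ≡true λ eq → contradiction (trans (sym tail∈X) (trans eq head∉X)) λ ()

  orient : ∀ {R : V → V → Set} → (∀ {u v} → R u v → R v u) →
           ∀ o → R (tl (proj₁ o)) (hd (proj₁ o)) → R (otail G o) (ohead G o)
  orient R-sym (e , true)  r = r
  orient R-sym (e , false) r = R-sym r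

  δ≡true⇒ohead-flips : ∀ X o → δ G X (proj₁ o) ≡ true → X (ohead G o) ≡ not (X (otail G o))
  δ≡true⇒ohead-flips X o δo =
    ¬-not (orient {R = λ u v → X u ≢ X v} (_∘ sym) o (δ≡true⇒sidesDiffer X δo) ∘ sym)

  record Walk (Q : E → Set) (u v : V) : Set where
    constructor walk
    field
      steps   : List (OEdge G)
      linked  : Linked G u steps v
      allowed : All (Q ∘ proj₁) steps

  module _ {Q : E → Set} where

    walk-[] : ∀ {u} → Walk Q u u
    walk-[] = walk [] refl []

    walk-edge : ∀ {e} → Q e → Walk Q (tl e) (hd e)
    walk-edge q = walk [ _ , true ] (refl , refl) (q ∷ [])

    walk-edgeʳ : ∀ {e} → Q e → Walk Q (hd e) (tl e)
    walk-edgeʳ q = walk [ _ , false ] (refl , refl) (q ∷ [])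

    walk-++ : ∀ {u v w} → Walk Q u v → Walk Q v w → Walk Q u w
    walk-++ (walk [] refl []) w₂ = w₂
    walk-++ (walk (o ∷ os) (t , lk) (q ∷ qs)) w₂ with walk-++ (walk os lk qs) w₂
    ... | walk ps lk′ qs′ = walk (o ∷ ps) (t , lk′) (q ∷ qs′)

    walk-map : ∀ {R : E → Set} {u v} → (∀ {e} → Q e → R e) → Walk Q u v → Walk R u v
    walk-map f (walk os lk qs) = walk os lk (All.map f qs)

    walk-invariant : ∀ {B : Set} (F : V → B) → (∀ {e} → Q e → F (tl e) ≡ F (hd e)) →
                     ∀ {u v} → Walk Q u v → F u ≡ F v
    walk-invariant F inv (walk [] refl []) = refl
    walk-invariant F inv (walk (o ∷ os) (refl , lk) (q ∷ qs)) =
      trans (orient {R = λ u v → F u ≡ F v} sym o (inv q)) (walk-invariant F inv (walk os lk qs))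

  record Components (Q : E → Set) (es : List E) : Set where
    field
      label      : V → V
      connect    : ∀ {u v} → label u ≡ label v → Walk Q u v
      label-edge : All (λ e → Q e → label (tl e) ≡ label (hd e)) es

  merge : (V → V) → V → V → V → V
  merge L a b v with L v ≟ᶠ b
  ... | yes _ = a
  ... | no  _ = L v

  merge-cong : ∀ L a b {x y} → L x ≡ L y → merge L a b x ≡ merge L a b y
  merge-cong L a b {x} {y} eq with L x ≟ᶠ b | L y ≟ᶠ b
  ... | yes _  | yes _  = refl
  ... | yes p  | no ¬q = contradiction (trans (sym eq) p) ¬q
  ... | no ¬p | yes q  = contradiction (trans eq q) ¬p
  ... | no _   | no _   = eq

  module _ {Q : E → Set} (Q? : Decidable Q) where

    components-of : ∀ es → Components Q es
    components-of [] =
      record { label = λ v → v ; connect = λ eq → subst (Walk Q _) eq walk-[] ; label-edge = [] }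
    components-of (f ∷ es) with components-of es | Q? f
    ... | record { label = L ; connect = connect ; label-edge = closed } | no ¬q =
      record { label = L ; connect = connect ; label-edge = (λ q → contradiction q ¬q) ∷ closed }
    ... | record { label = L ; connect = connect ; label-edge = closed } | yes q = record
      { label      = L′
      ; connect    = connect′
      ; label-edge = (λ _ → joined) ∷ All.map (λ inv q′ → merge-cong L _ _ (inv q′)) closed
      }
      where
        L′ : V → V
        L′ = merge L (L (tl f)) (L (hd f))

        joined : L′ (tl f) ≡ L′ (hd f)
        joined with L (tl f) ≟ᶠ L (hd f) | L (hd f) ≟ᶠ L (hd f)
        ... | _ | no ¬r = contradiction refl ¬r
        ... | yes _ | yes _ = refl
        ... | no _  | yes _ = refl

        connect′ : ∀ {u v} → L′ u ≡ L′ v → Walk Q u v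
        connect′ {u} {v} with L u ≟ᶠ L (hd f) | L v ≟ᶠ L (hd f)
        ... | yes p | yes r = λ _ → connect (trans p (sym r))
        ... | yes p | no _  = λ eq → walk-++ (connect p) (walk-++ (walk-edgeʳ q) (connect eq))
        ... | no _  | yes r = λ eq → walk-++ (connect eq) (walk-++ (walk-edge q) (connect (sym r)))
        ... | no _  | no _  = connect

  record Component (Q : E → Set) (r : V) : Set where
    field
      member : VSet G
      root   : member r ≡ true
      reach  : ∀ {v} → member v ≡ true → Walk Q r v
      closed : ∀ {e} → Q e → member (tl e) ≡ member (hd e)

    reach⇒member : ∀ {v} → Walk Q r v → member v ≡ true
    reach⇒member w = trans (sym (walk-invariant member closed w)) root

    reachable? : ∀ v → Dec (Walk Q r v)
    reachable? v with member v in m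
    ... | true  = yes (reach m)
    ... | false = no λ w → contradiction (trans (sym m) (reach⇒member w)) λ ()

  component : ∀ {Q : E → Set} → Decidable Q → (r : V) → Component Q r
  component {Q} Q? r = record
    { member = λ v → does (label v ≟ᶠ label r)
    ; root   = root
    ; reach  = reach
    ; closed = λ q → cong (λ l → does (l ≟ᶠ label r)) (All.lookup label-edge (∈-allFin _) q)
    }
    where
      open Components (components-of Q? (allFin nE))

      root : does (label r ≟ᶠ label r) ≡ true
      root with label r ≟ᶠ label r
      ... | yes _ = refl
      ... | no ¬p = contradiction refl ¬p

      reach : ∀ {v} → does (label v ≟ᶠ label r) ≡ true → Walk Q r v
      reach {v} with label v ≟ᶠ label r
      ... | yes p = λ _ → connect (sym p)
      ... | no _  = λ ()

  walk? : ∀ {Q : E → Set} → Decidable Q → ∀ u v → Dec (Walk Q u v)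
  walk? Q? u = Component.reachable? (component Q? u)

  record SimpleWalk (Q : E → Set) (u v : V) : Set where
    constructor simple
    field
      path     : Walk Q u v
      distinct : Unique (u ∷ map (ohead G) (Walk.steps path))

  module _ {Q : E → Set} where

    simple-suffix : ∀ {u x w} → (s : SimpleWalk Q x w) →
                    Any (u ≡_) (x ∷ map (ohead G) (Walk.steps (SimpleWalk.path s))) → SimpleWalk Q u w
    simple-suffix s (here refl) = s
    simple-suffix (simple (walk (o ∷ os) (_ , lk) (_ ∷ qs)) (_ ∷ un)) (there p) =
      simple-suffix (simple (walk os lk qs) un) p

    simplify : ∀ {u v} → Walk Q u v → SimpleWalk Q u v
    simplify (walk [] lk []) = simple (walk [] lk []) ([] ∷ [])
    simplify {u} (walk (o ∷ os) (t , lk) (q ∷ qs)) with simplify (walk os lk qs)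
    ... | s@(simple (walk os′ lk′ qs′) un′) with any? (u ≟ᶠ_) (ohead G o ∷ map (ohead G) os′)
    ...   | yes p  = simple-suffix s p
    ...   | no ¬p = simple (walk (o ∷ os′) (t , lk′) (q ∷ qs′)) (¬Any⇒All¬ _ ¬p ∷ un′)

  ohead-end : ∀ e b b′ → ohead G (e , b′) ≡ otail G (e , b) ⊎ ohead G (e , b′) ≡ ohead G (e , b)
  ohead-end e true  true  = inj₂ refl
  ohead-end e true  false = inj₁ refl
  ohead-end e false true  = inj₁ refl
  ohead-end e false false = inj₂ refl

  simple⇒edgesDistinct : ∀ {u v} os → Linked G u os v → Unique (u ∷ map (ohead G) os) →
                         Unique (map proj₁ os)
  simple⇒edgesDistinct [] _ _ = []
  simple⇒edgesDistinct ((e , b) ∷ os) (refl , lk) ((_ ∷ tail∉) ∷ un@(head∉ ∷ _)) =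
    new ∷ simple⇒edgesDistinct os lk un
    where
      new : All (e ≢_) (map proj₁ os)
      new = map⁺ (All.zipWith (λ {o} → distinct o) (map⁻ tail∉ , map⁻ head∉))
        where
          distinct : ∀ o → otail G (e , b) ≢ ohead G o × ohead G (e , b) ≢ ohead G o → e ≢ proj₁ o
          distinct (_ , b′) (≢tail , ≢head) refl = [ ≢tail ∘ sym , ≢head ∘ sym ]′ (ohead-end e b b′)

  vertices : ∀ {u v} os → Linked G u os v → u ∷ map (ohead G) os ≡ map (otail G) os ++ [ v ]
  vertices []       refl       = refl
  vertices (o ∷ os) (refl , lk) = cong (otail G o ∷_) (vertices os lk)

  ¬Q⇒∉ : ∀ {Q : E → Set} {f} → ¬ Q f →
         ∀ {os : List (OEdge G)} → All (Q ∘ proj₁) os → All (f ≢_) (map proj₁ os)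
  ¬Q⇒∉ {Q} ¬Qf qs = map⁺ (All.map (λ q f≡ → ¬Qf (subst Q (sym f≡) q)) qs)

  cycleThrough : ∀ {Q : E → Set} e → ¬ Q e → SimpleWalk Q (hd e) (tl e) → Cycle G
  cycleThrough {Q} e ¬Qe (simple (walk os lk qs) un) = record
    { oedges    = (e , true) ∷ os
    ; nonempty  = λ ()
    ; closed    = tl e , refl , lk
    ; distinctV = Unique-rotate (map (otail G) os) (tl e) (subst Unique (vertices os lk) un)
    ; distinctE = ¬Q⇒∉ ¬Qe qs ∷ simple⇒edgesDistinct os lk un
    }

  OffCut : VSet G → E → Set
  OffCut X e = δ G X e ≡ false

  -- A nonempty cut δ Y inside δ X separates no two vertices of X, nor of Z, hence all of X from Z.
  separated-cut⇒bond : ∀ (X Z : VSet G) {x z} →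
    (∀ {v} → X v ≡ true → Walk (OffCut X) x v) →
    (∀ {v} → Z v ≡ true → Walk (OffCut X) z v) →
    (∀ {e} → δ G X e ≡ true → (X (tl e) ≡ true × Z (hd e) ≡ true) ⊎ (Z (tl e) ≡ true × X (hd e) ≡ true)) →
    NonemptyE G (δ G X) → IsBond G (δ G X)
  separated-cut⇒bond X Z {x} {z} reachX reachZ across nonempty =
    (X , λ _ → refl) , nonempty , minimal
    where
      minimal : ∀ S → IsEdgeCut G S → NonemptyE G S → _⊆ᴱ_ G S (δ G X) → _≐ᴱ_ G S (δ G X)
      minimal S (Y , S≐δY) (e₀ , e₀∈S) S⊆δX = S≐δX
        where
          offCut⇒∉S : ∀ {e} → δ G X e ≡ false → S e ≡ false
          offCut⇒∉S {e} off with S e in s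
          ... | false = refl
          ... | true  = ⊥-elim (subst T off (S⊆δX e (subst T (sym s) _)))

          Y-const : ∀ {w v} → Walk (OffCut X) w v → Y w ≡ Y v
          Y-const = walk-invariant Y λ {e} off →
            δ≡false⇒sameSide Y (trans (sym (S≐δY e)) (offCut⇒∉S off))

          Y-Across : E → Set
          Y-Across e = (Y (tl e) ≡ Y x × Y (hd e) ≡ Y z) ⊎ (Y (tl e) ≡ Y z × Y (hd e) ≡ Y x)

          Y-across : ∀ {e} → δ G X e ≡ true → Y-Across e
          Y-across δe with across δe
          ... | inj₁ (xt , zh) = inj₁ (sym (Y-const (reachX xt)) , sym (Y-const (reachZ zh)))
          ... | inj₂ (zt , xh) = inj₂ (sym (Y-const (reachZ zt)) , sym (Y-const (reachX xh)))

          S≐δX : _≐ᴱ_ G S (δ G X)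
          S≐δX with Y x ≟ᵇ Y z
          ... | yes same = ⊥-elim (subst T e₀∉S e₀∈S)
            where
              sameSide : ∀ {e} → Y-Across e → Y (tl e) ≡ Y (hd e)
              sameSide (inj₁ (t , h)) = trans t (trans same (sym h))
              sameSide (inj₂ (t , h)) = trans t (trans (sym same) (sym h))

              e₀∉S : S e₀ ≡ false
              e₀∉S = trans (S≐δY e₀)
                (sameSide⇒δ≡false Y (sameSide (Y-across (Equivalence.to T-≡ (S⊆δX e₀ e₀∈S)))))
          ... | no differ = S≡δX
            where
              sidesDiffer : ∀ {e} → Y-Across e → Y (tl e) ≢ Y (hd e)
              sidesDiffer (inj₁ (t , h)) eq = differ (trans (sym t) (trans eq h))
              sidesDiffer (inj₂ (t , h)) eq = differ (trans (sym h) (trans (sym eq) t))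

              S≡δX : ∀ e → S e ≡ δ G X e
              S≡δX e with δ G X e in δe
              ... | false = offCut⇒∉S δe
              ... | true  = trans (S≐δY e) (sidesDiffer⇒δ≡true Y (sidesDiffer (Y-across δe)))

  record SeparatingBond (Q : E → Set) (t : E) : Set where
    field
      side      : VSet G
      bond      : IsBond G (δ G side)
      tail∈side : side (tl t) ≡ true
      head∉side : side (hd t) ≡ false
      Q⇒offCut  : ∀ {f} → Q f → δ G side f ≡ false

  -- Z is the Q-component of hd t and X the component of tl t in the graph outside Z;
  -- every edge leaving X enters Z.
  separatingBond : ∀ {Q : E → Set} → Decidable Q → ∀ t → ¬ Walk Q (hd t) (tl t) → SeparatingBond Q t
  separatingBond {Q} Q? t unjoined = record
    { side = X ; bond = bond ; tail∈side = X.root ; head∉side = X-hd ; Q⇒offCut = Q⇒off }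
    where
      module Z = Component (component Q? (hd t))
      Z : VSet G
      Z = Z.member

      Outside : E → Set
      Outside f = Z (tl f) ≡ false × Z (hd f) ≡ false

      module X = Component (component (λ f → (Z (tl f) ≟ᵇ false) ×-dec (Z (hd f) ≟ᵇ false)) (tl t))
      X : VSet G
      X = X.member

      Z-tl : Z (tl t) ≡ false
      Z-tl with Z (tl t) in zt
      ... | false = refl
      ... | true  = contradiction (Z.reach zt) unjoined

      X⇒¬Z : ∀ {v} → X v ≡ true → Z v ≡ false
      X⇒¬Z xv = trans (sym (walk-invariant Z (λ (zt , zh) → trans zt (sym zh)) (X.reach xv))) Z-tl

      Z⇒¬X : ∀ {v} → Z v ≡ true → X v ≡ false
      Z⇒¬X {v} zv with X v in xv
      ... | false = refl
      ... | true  = contradiction (trans (sym zv) (X⇒¬Z xv)) λ ()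

      X-hd : X (hd t) ≡ false
      X-hd = Z⇒¬X Z.root

      outside⇒off : ∀ {f} → Outside f → δ G X f ≡ false
      outside⇒off out = sameSide⇒δ≡false X (X.closed out)

      Q⇒off : ∀ {f} → Q f → δ G X f ≡ false
      Q⇒off {f} q with Z (tl f) in zt
      ... | true  = sameSide⇒δ≡false X (trans (Z⇒¬X zt) (sym (Z⇒¬X (trans (sym (Z.closed q)) zt))))
      ... | false = outside⇒off (zt , trans (sym (Z.closed q)) zt)

      enters-Z : ∀ {e} → X (tl e) ≢ X (hd e) → Z (tl e) ≡ true ⊎ Z (hd e) ≡ true
      enters-Z {e} differ with Z (tl e) in zt | Z (hd e) in zh
      ... | true  | _     = inj₁ refl
      ... | false | true  = inj₂ refl
      ... | false | false = contradiction (X.closed (zt , zh)) differ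

      leaves-into-X : ∀ {e} → δ G X e ≡ true → X (tl e) ≡ false → X (hd e) ≡ true
      leaves-into-X {e} δe xt = trans (δ≡true⇒ohead-flips X (e , true) δe) (cong not xt)

      across : ∀ {e} → δ G X e ≡ true →
               (X (tl e) ≡ true × Z (hd e) ≡ true) ⊎ (Z (tl e) ≡ true × X (hd e) ≡ true)
      across {e} δe with X (tl e) in xt | enters-Z (δ≡true⇒sidesDiffer X δe)
      ... | true  | inj₁ zt = contradiction (trans (sym zt) (X⇒¬Z xt)) λ ()
      ... | true  | inj₂ zh = inj₁ (refl , zh)
      ... | false | inj₁ zt = inj₂ (zt , leaves-into-X δe xt)
      ... | false | inj₂ zh = contradiction (trans (sym zh) (X⇒¬Z (leaves-into-X δe xt))) λ ()

      bond : IsBond G (δ G X)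
      bond = separated-cut⇒bond X Z
        (walk-map outside⇒off ∘ X.reach) (walk-map Q⇒off ∘ Z.reach) across
                                (t , Equivalence.from T-≡ (leaves⇒δ≡true X X.root X-hd))

module CommutativeMonoidSums {c ℓ} (M : CommutativeMonoid c ℓ) where
  open CommutativeMonoid M
    renaming (Carrier to A; _∙_ to _+_; ε to 0#; refl to ≈-refl; sym to ≈-sym; trans to ≈-trans)
  open import Algebra.Properties.CommutativeMonoid.Sum M public
    using (sum; sum-cong-≋; ∑-distrib-+; sum-remove; sum-replicate-zero)

  sum-zero : ∀ {n} (f : Vector A n) → (∀ i → f i ≈ 0#) → sum f ≈ 0#
  sum-zero {n} f f≈0 = ≈-trans (sum-cong-≋ f≈0) (sum-replicate-zero n)

  sum-single : ∀ {n} (f : Vector A n) i → (∀ j → j ≢ i → f j ≈ 0#) → sum f ≈ f i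
  sum-single {suc n} f i off = begin
    sum f                    ≈⟨ sum-remove f ⟩
    f i + sum (removeAt f i) ≈⟨ ∙-congˡ (sum-zero _ λ j → off (punchIn i j) (punchInᵢ≢i i j)) ⟩
    f i + 0#                 ≈⟨ identityʳ (f i) ⟩
    f i                      ∎
    where open ≈-Reasoning setoid

  point : ∀ {n} → Fin n → A → Vector A n
  point i x j = if does (i ≟ᶠ j) then x else 0#

  sum-point : ∀ {n} (i : Fin n) x → sum (point i x) ≈ x
  sum-point i x = ≈-trans (sum-single (point i x) i off) at-i
    where
      off : ∀ j → j ≢ i → point i x j ≈ 0#
      off j j≢i with i ≟ᶠ j
      ... | yes i≡j = contradiction (sym i≡j) j≢i
      ... | no _    = ≈-refl

      at-i : point i x i ≈ x
      at-i with i ≟ᶠ i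
      ... | yes _  = ≈-refl
      ... | no i≢i = contradiction refl i≢i

module AbelianGroupSums {c ℓ} (Γ : AbelianGroup c ℓ) where
  open AbelianGroup Γ
    renaming (Carrier to A; _∙_ to _+_; refl to ≈-refl; sym to ≈-sym; trans to ≈-trans)
  open CommutativeMonoidSums commutativeMonoid public
  open import Algebra.Properties.Group group using (∙-cancelʳ)

  sum-cancel : ∀ {n} (f g : Vector A n) i → (∀ j → j ≢ i → f j ≈ g j) → sum f ≈ sum g → f i ≈ g i
  sum-cancel {suc n} f g i agree f≈g = ∙-cancelʳ (sum (removeAt f i)) (f i) (g i) (begin
    f i + sum (removeAt f i) ≈⟨ sum-remove f ⟨
    sum f                    ≈⟨ f≈g ⟩
    sum g                    ≈⟨ sum-remove g ⟩
    g i + sum (removeAt g i) ≈⟨ ∙-congˡ (sum-cong-≋ λ j → agree (punchIn i j) (punchInᵢ≢i i j)) ⟨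
    g i + sum (removeAt f i) ∎)
    where open ≈-Reasoning setoid

module Gains {c ℓ} (Γ : AbelianGroup c ℓ) (G : Graph) where
  open AbelianGroup Γ
    renaming (Carrier to A; _∙_ to _+_; ε to 0#; _⁻¹ to -_;
              refl to ≈-refl; sym to ≈-sym; trans to ≈-trans; reflexive to ≈-reflexive)
  open import Algebra.Properties.Group group
    using (ε⁻¹≈ε; ⁻¹-involutive; \\-leftDividesˡ; identityˡ-unique)
  open import Algebra.Properties.AbelianGroup Γ using (⁻¹-∙-comm)
  open Group group using (_\\_)
  open ≈-Reasoning setoid
  open AbelianGroupSums Γ
  open GainDefs Γ G
  open GraphProperties G

  ≋-refl : ∀ {φ} → φ ≋ φ
  ≋-refl _ = ≈-refl

  cutTerm : GainFn → VSet G → Bool → E → A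
  cutTerm φ X away e = if δ G X e then (if X (tl e) xor not away then φ e else - φ e) else 0#

  sumE≡sum : ∀ {k} (f : Fin k → A) → sumE f ≡ sum f
  sumE≡sum {zero}  f = refl
  sumE≡sum {suc k} f = cong (f Fin.zero +_) (sumE≡sum (f ∘ Fin.suc))

  bondGain≈sum : ∀ φ X away → bondGain φ X away ≈ sum (cutTerm φ X away)
  bondGain≈sum φ X away = ≈-reflexive (sumE≡sum (cutTerm φ X away))

  cutTerm-cong : ∀ {φ χ} X away {e} → (δ G X e ≡ true → φ e ≈ χ e) →
                 cutTerm φ X away e ≈ cutTerm χ X away e
  cutTerm-cong X away {e} φ≈χ with δ G X e
  ... | false = ≈-refl
  ... | true with X (tl e) xor not away
  ...   | true  = φ≈χ refl
  ...   | false = ⁻¹-cong (φ≈χ refl)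

  cutTerm-⊕ : ∀ φ χ X away e → cutTerm (φ ⊕ χ) X away e ≈ cutTerm φ X away e + cutTerm χ X away e
  cutTerm-⊕ φ χ X away e with δ G X e
  ... | false = ≈-sym (identityˡ 0#)
  ... | true with X (tl e) xor not away
  ...   | true  = ≈-refl
  ...   | false = ≈-sym (⁻¹-∙-comm (φ e) (χ e))

  bondGain-cong : ∀ {φ χ} → φ ≋ χ → ∀ X away → bondGain φ X away ≈ bondGain χ X away
  bondGain-cong {φ} {χ} φ≋χ X away = begin
    bondGain φ X away      ≈⟨ bondGain≈sum φ X away ⟩
    sum (cutTerm φ X away) ≈⟨ sum-cong-≋ (λ e → cutTerm-cong {φ} {χ} X away λ _ → φ≋χ e) ⟩
    sum (cutTerm χ X away) ≈⟨ bondGain≈sum χ X away ⟨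
    bondGain χ X away      ∎

  bondGain-⊕ : ∀ φ χ X away → bondGain (φ ⊕ χ) X away ≈ bondGain φ X away + bondGain χ X away
  bondGain-⊕ φ χ X away = begin
    bondGain (φ ⊕ χ) X away                   ≈⟨ bondGain≈sum (φ ⊕ χ) X away ⟩
    sum (cutTerm (φ ⊕ χ) X away)              ≈⟨ sum-cong-≋ (cutTerm-⊕ φ χ X away) ⟩
    sum (λ e → tφ e + tχ e)                   ≈⟨ ∑-distrib-+ tφ tχ ⟩
    sum tφ + sum tχ                           ≈⟨ ∙-cong (bondGain≈sum φ X away)
                                                           (bondGain≈sum χ X away) ⟨
    bondGain φ X away + bondGain χ X away     ∎
    where
      tφ tχ : E → A
      tφ = cutTerm φ X away
      tχ = cutTerm χ X away

  dirGain : A → Maybe Bool → A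
  dirGain a (just true)  = a
  dirGain a (just false) = - a
  dirGain a nothing      = 0#

  ψC≡dirGain : ∀ C a e → ψC C a e ≡ dirGain a (dirIn (Cycle.oedges C) e)
  ψC≡dirGain C a e with dirIn (Cycle.oedges C) e
  ... | just true  = refl
  ... | just false = refl
  ... | nothing    = refl

  dirIn-∉ : ∀ {f} os → All (f ≢_) (map proj₁ os) → dirIn os f ≡ nothing
  dirIn-∉ [] _ = refl
  dirIn-∉ {f} ((g , b) ∷ os) (f≢g ∷ f∉) with g ≟ᶠ f
  ... | yes g≡f = contradiction (sym g≡f) f≢g
  ... | no _    = dirIn-∉ os f∉

  -- crossing o is what the gain a placed on o contributes to the cut gain of δ X;
  -- it is the drop of potential along o.
  module Crossings (X : VSet G) (away : Bool) (a : A) where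

    potential : V → A
    potential v = if X v xor not away then a else 0#

    crossing : OEdge G → A
    crossing o = if δ G X (proj₁ o) then (if X (otail G o) xor not away then a else - a) else 0#

    crossing-step : ∀ o → crossing o + potential (ohead G o) ≈ potential (otail G o)
    crossing-step o with δ G X (proj₁ o) in δo
    ... | false rewrite orient {R = λ u v → X u ≡ X v} sym o (δ≡false⇒sameSide X δo) = identityˡ _
    ... | true rewrite δ≡true⇒ohead-flips X o δo
                     | sym (not-distribˡ-xor (X (otail G o)) (not away))
                with X (otail G o) xor not away
    ...   | true  = identityʳ a
    ...   | false = inverseˡ a

    crossings : List (OEdge G) → A
    crossings []       = 0#
    crossings (o ∷ os) = crossing o + crossings os

    crossings-telescope : ∀ {u v} os → Linked G u os v → crossings os + potential v ≈ potential u
    crossings-telescope []       refl        = identityˡ _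
    crossings-telescope (o ∷ os) (refl , lk) = begin
      (crossing o + crossings os) + potential _ ≈⟨ assoc _ _ _ ⟩
      crossing o + (crossings os + potential _) ≈⟨ ∙-congˡ (crossings-telescope os lk) ⟩
      crossing o + potential (ohead G o)        ≈⟨ crossing-step o ⟩
      potential (otail G o)                     ∎

    closed-walk-crossings : ∀ {v} os → Linked G v os v → crossings os ≈ 0#
    closed-walk-crossings os lk = identityˡ-unique _ _ (crossings-telescope os lk)

    crossingAt : List (OEdge G) → E → A
    crossingAt os e = maybe′ (λ b → crossing (e , b)) 0# (dirIn os e)

    cutTerm-dirGain : ∀ os e → cutTerm (λ f → dirGain a (dirIn os f)) X away e ≈ crossingAt os e
    cutTerm-dirGain os e with dirIn os e
    ... | just true  = ≈-refl
    ... | just false with δ G X e in δe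
    ...   | false = ≈-refl
    ...   | true rewrite δ≡true⇒ohead-flips X (e , true) δe
                         | sym (not-distribˡ-xor (X (tl e)) (not away))
                  with X (tl e) xor not away
    ...     | true  = ≈-refl
    ...     | false = ⁻¹-involutive a
    cutTerm-dirGain os e | nothing with δ G X e
    ... | false = ≈-refl
    ... | true with X (tl e) xor not away
    ...   | true  = ≈-refl
    ...   | false = ε⁻¹≈ε

    crossingAt-∷ : ∀ g b os → All (g ≢_) (map proj₁ os) → ∀ e →
                   crossingAt ((g , b) ∷ os) e ≈ point g (crossing (g , b)) e + crossingAt os e
    crossingAt-∷ g b os g∉ e with g ≟ᶠ e
    ... | yes refl rewrite dirIn-∉ os g∉ = ≈-sym (identityʳ _)
    ... | no _    = ≈-sym (identityˡ _)

    sum-crossingAt : ∀ os → Unique (map proj₁ os) → sum (crossingAt os) ≈ crossings os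
    sum-crossingAt []             []        = sum-zero (crossingAt []) (λ _ → ≈-refl)
    sum-crossingAt ((g , b) ∷ os) (g∉ ∷ un) = begin
      sum (crossingAt ((g , b) ∷ os))              ≈⟨ sum-cong-≋ (crossingAt-∷ g b os g∉) ⟩
      sum (λ e → point g x e + crossingAt os e)    ≈⟨ ∑-distrib-+ (point g x) (crossingAt os) ⟩
      sum (point g x) + sum (crossingAt os)        ≈⟨ ∙-cong (sum-point g x) (sum-crossingAt os un) ⟩
      x + crossings os                             ∎
      where
        x : A
        x = crossing (g , b)

  bondGain-ψC≈0 : ∀ C a X away → bondGain (ψC C a) X away ≈ 0#
  bondGain-ψC≈0 C a X away with Cycle.closed C
  ... | v , lk = begin
    bondGain (ψC C a) X away       ≈⟨ bondGain≈sum (ψC C a) X away ⟩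
    sum (cutTerm (ψC C a) X away)  ≈⟨ sum-cong-≋ cutTerm≈crossingAt ⟩
    sum (crossingAt os)            ≈⟨ sum-crossingAt os (Cycle.distinctE C) ⟩
    crossings os                   ≈⟨ closed-walk-crossings os lk ⟩
    0#                             ∎
    where
      open Crossings X away a
      os : List (OEdge G)
      os = Cycle.oedges C

      cutTerm≈crossingAt : ∀ e → cutTerm (ψC C a) X away e ≈ crossingAt os e
      cutTerm≈crossingAt e = ≈-trans
        (cutTerm-cong {ψC C a} {λ f → dirGain a (dirIn os f)} X away
                      λ _ → ≈-reflexive (ψC≡dirGain C a e))
        (cutTerm-dirGain os e)

  bondGain-shift : ∀ φ C a X away → bondGain (φ ⊕ ψC C a) X away ≈ bondGain φ X away
  bondGain-shift φ C a X away = begin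
    bondGain (φ ⊕ ψC C a) X away                  ≈⟨ bondGain-⊕ φ (ψC C a) X away ⟩
    bondGain φ X away + bondGain (ψC C a) X away  ≈⟨ ∙-congˡ (bondGain-ψC≈0 C a X away) ⟩
    bondGain φ X away + 0#                        ≈⟨ identityʳ _ ⟩
    bondGain φ X away                             ∎

  ShiftEquiv⇒bondGain≈ : ∀ {φ ψ} → ShiftEquiv φ ψ → ∀ X away → bondGain φ X away ≈ bondGain ψ X away
  ShiftEquiv⇒bondGain≈ (done φ≋ψ)      X away = bondGain-cong φ≋ψ X away
  ShiftEquiv⇒bondGain≈ (shift C a φ~ψ) X away =
    ≈-trans (≈-sym (bondGain-shift _ C a X away)) (ShiftEquiv⇒bondGain≈ φ~ψ X away)

  ShiftEquiv-respˡ : ∀ {φ χ ψ} → φ ≋ χ → ShiftEquiv χ ψ → ShiftEquiv φ ψ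
  ShiftEquiv-respˡ φ≋χ (done χ≋ψ)      = done (λ e → ≈-trans (φ≋χ e) (χ≋ψ e))
  ShiftEquiv-respˡ φ≋χ (shift C a χ~ψ) = shift C a (ShiftEquiv-respˡ (λ e → ∙-congʳ (φ≋χ e)) χ~ψ)

  ShiftEquiv-trans : ∀ {φ χ ψ} → ShiftEquiv φ χ → ShiftEquiv χ ψ → ShiftEquiv φ ψ
  ShiftEquiv-trans (done φ≋χ)      χ~ψ = ShiftEquiv-respˡ φ≋χ χ~ψ
  ShiftEquiv-trans (shift C a φ~χ) χ~ψ = shift C a (ShiftEquiv-trans φ~χ χ~ψ)

  cut-determines-edge : ∀ {φ χ} X {e} → X (tl e) ≡ true → X (hd e) ≡ false →
    (∀ {f} → f ≢ e → δ G X f ≡ true → φ f ≈ χ f) →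
    bondGain φ X true ≈ bondGain χ X true → φ e ≈ χ e
  cut-determines-edge {φ} {χ} X {e} tail∈X head∉X agree φ≈χ =
    subst₂ _≈_ (term-at-e φ) (term-at-e χ)
      (sum-cancel (cutTerm φ X true) (cutTerm χ X true) e
        (λ f f≢e → cutTerm-cong {φ} {χ} X true (agree f≢e))
        (≈-trans (≈-sym (bondGain≈sum φ X true)) (≈-trans φ≈χ (bondGain≈sum χ X true))))
    where
      term-at-e : ∀ ϑ → cutTerm ϑ X true e ≡ ϑ e
      term-at-e ϑ rewrite leaves⇒δ≡true X tail∈X head∉X | tail∈X = refl

  module _ {Q : E → Set} {e} (¬Qe : ¬ Q e) (w : SimpleWalk Q (hd e) (tl e)) (a : A) where
    open SimpleWalk w using (path)

    ψC-cycleThrough-self : ψC (cycleThrough e ¬Qe w) a e ≡ a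
    ψC-cycleThrough-self with e ≟ᶠ e
    ... | yes _  = refl
    ... | no e≢e = contradiction refl e≢e

    ψC-cycleThrough-off : ∀ {f} → ¬ Q f → f ≢ e → ψC (cycleThrough e ¬Qe w) a f ≡ 0#
    ψC-cycleThrough-off {f} ¬Qf f≢e = trans (ψC≡dirGain (cycleThrough e ¬Qe w) a f)
      (cong (dirGain a) (dirIn-∉ ((e , true) ∷ Walk.steps path)
                                 (f≢e ∷ ¬Q⇒∉ ¬Qf (Walk.allowed path))))

  module _ (φ ψ : GainFn)
           (bonds≈ : ∀ X away → IsBond G (δ G X) → bondGain φ X away ≈ bondGain ψ X away) where

    ShiftedFrom : ℕ → Set (c ⊔ ℓ)
    ShiftedFrom j = Σ GainFn λ φ′ → ShiftEquiv φ φ′ × (∀ f → j ℕ.≤ toℕ f → φ′ f ≈ ψ f)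

    agree-from : ∀ {ϑ : GainFn} e → ϑ e ≈ ψ e → (∀ f → e < f → ϑ f ≈ ψ f) → ∀ f → e ≤ f → ϑ f ≈ ψ f
    agree-from e at-e above f e≤f with f ≟ᶠ e
    ... | yes refl = at-e
    ... | no f≢e   = above f (≤∧≢⇒< e≤f (f≢e ∘ sym))

    cycle-edge : ∀ {φ′} e → Walk (_< e) (hd e) (tl e) → (∀ f → e < f → φ′ f ≈ ψ f) →
                 Σ GainFn λ φ″ → ShiftEquiv φ′ φ″ × (∀ f → e ≤ f → φ″ f ≈ ψ f)
    cycle-edge {φ′} e w above = φ′ ⊕ ψC C a , shift C a (done ≋-refl) , agree-from e at-e above′
      where
        sw : SimpleWalk (_< e) (hd e) (tl e)
        sw = simplify w
        C : Cycle G
        C = cycleThrough e (<-irrefl refl) sw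
        a : A
        a = φ′ e \\ ψ e

        at-e : φ′ e + ψC C a e ≈ ψ e
        at-e = begin
          φ′ e + ψC C a e ≈⟨ ∙-congˡ (≈-reflexive (ψC-cycleThrough-self (<-irrefl refl) sw a)) ⟩
          φ′ e + a        ≈⟨ \\-leftDividesˡ (φ′ e) (ψ e) ⟩
          ψ e             ∎

        above′ : ∀ f → e < f → φ′ f + ψC C a f ≈ ψ f
        above′ f e<f = begin
          φ′ f + ψC C a f ≈⟨ ∙-congˡ (≈-reflexive (ψC-cycleThrough-off (<-irrefl refl) sw a
                                                     (<-asym e<f) (<⇒≢ e<f ∘ sym))) ⟩
          φ′ f + 0#       ≈⟨ identityʳ (φ′ f) ⟩
          φ′ f            ≈⟨ above f e<f ⟩
          ψ f             ∎

    bond-edge : ∀ {φ′} e → ShiftEquiv φ φ′ → ¬ Walk (_< e) (hd e) (tl e) →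
                (∀ f → e < f → φ′ f ≈ ψ f) → φ′ e ≈ ψ e
    bond-edge e φ~φ′ ¬w above = cut-determines-edge side tail∈side head∉side
      (λ f≢e f∈δ → above _ (later f≢e f∈δ))
      (≈-trans (≈-sym (ShiftEquiv⇒bondGain≈ φ~φ′ side true)) (bonds≈ side true bond))
      where
        open SeparatingBond (separatingBond (_<ᶠ? e) e ¬w)

        later : ∀ {f} → f ≢ e → δ G side f ≡ true → e < f
        later {f} f≢e f∈δ with <-cmp f e
        ... | tri< f<e _ _ = contradiction (trans (sym f∈δ) (Q⇒offCut f<e)) λ ()
        ... | tri≈ _ f≡e _ = contradiction f≡e f≢e
        ... | tri> _ _ e<f = e<f

    fix-edge : ∀ e → ShiftedFrom (suc (toℕ e)) → ShiftedFrom (toℕ e)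
    fix-edge e (φ′ , φ~φ′ , above) with walk? (_<ᶠ? e) (hd e) (tl e)
    ... | yes w with cycle-edge e w above
    ...   | φ″ , φ′~φ″ , agree = φ″ , ShiftEquiv-trans φ~φ′ φ′~φ″ , agree
    fix-edge e (φ′ , φ~φ′ , above) | no ¬w =
      φ′ , φ~φ′ , agree-from e (bond-edge e φ~φ′ ¬w above) above

    nothing-fixed : ShiftedFrom (Graph.nE G)
    nothing-fixed = φ , done ≋-refl , λ f nE≤f → contradiction nE≤f (<⇒≱ (toℕ<n f))

    bondGain≈⇒ShiftEquiv : ShiftEquiv φ ψ
    bondGain≈⇒ShiftEquiv with downward-induction ShiftedFrom nothing-fixed fix-edge
    ... | φ′ , φ~φ′ , agree = ShiftEquiv-trans φ~φ′ (done λ f → agree f ℕ.z≤n)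

theorem4p3 : ∀ {c ℓ : Level} (Γ : AbelianGroup c ℓ) (G : Graph)
    (φ ψ : GainDefs.GainFn Γ G) →
    (GainDefs.ShiftEquiv Γ G φ ψ →
      ∀ (X : VSet G) (away : Bool) → IsBond G (δ G X) →
        AbelianGroup._≈_ Γ (GainDefs.bondGain Γ G φ X away) (GainDefs.bondGain Γ G ψ X away))
    ×
    ((∀ (X : VSet G) (away : Bool) → IsBond G (δ G X) →
        AbelianGroup._≈_ Γ (GainDefs.bondGain Γ G φ X away) (GainDefs.bondGain Γ G ψ X away)) →
      GainDefs.ShiftEquiv Γ G φ ψ)
theorem4p3 Γ G φ ψ = (λ φ~ψ X away _ → ShiftEquiv⇒bondGain≈ φ~ψ X away) , bondGain≈⇒ShiftEquiv φ ψ
  where open Gains Γ G
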